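{- Let $M$ be a real matrix such that every row of $M$ contains at most $s$ zeros. Then $\omega(M)\leqslant 2s+1$.
   Context: The rectangle graph $G(M)$ of a real matrix $M$ has as vertices the pairs $(i,j)$ with $M_{i,j}\neq 0$; two vertices $(i,j)$ and $(k,\ell)$ are adjacent iff $M_{i,\ell}=0$ or $M_{k,j}=0$. $\omega(M)$ denotes the clique number of $G(M)$ (the maximum size of a fooling set). -}

module Defs where

open import Level using (Level)
open import Data.Nat using (ℕ; _≤_)
open import Data.Fin using (Fin)
open import Data.Product using (_×_; _,_; ∃)
open import Data.Sum using (_⊎_)
open import Data.List using (List; length)
open import Data.List.Relation.Unary.All using (All)
open import Data.List.Relation.Unary.AllPairs using (AllPairs)
open import Data.List.Relation.Unary.Unique.Propositional using (Unique)
open import Relation.Binary.PropositionalEquality using (_≡_; _≢_)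

-- Only the zero/nonzero pattern matters, so we work over an arbitrary
-- carrier A with a distinguished element z playing the role of 0.
Matrix : ∀ {a} → Set a → ℕ → ℕ → Set a
Matrix A m n = Fin m → Fin n → A

module _ {a : Level} {A : Set a} (z : A) {m n : ℕ} (M : Matrix A m n) where

  Vertex : Fin m × Fin n → Set a
  Vertex (i , j) = M i j ≢ z

  Adjacent : Fin m × Fin n → Fin m × Fin n → Set a
  Adjacent (i , j) (k , l) = (M i l ≡ z) ⊎ (M k j ≡ z)

  IsClique : List (Fin m × Fin n) → Set a
  IsClique vs = Unique vs × All Vertex vs × AllPairs Adjacent vs

  CliqueNumber≤ : ℕ → Set a
  CliqueNumber≤ k = ∀ (vs : List (Fin m × Fin n)) → IsClique vs → length vs ≤ k

  RowZeros≤ : Fin m → ℕ → Set a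
  RowZeros≤ i s = ∀ (js : List (Fin n)) → Unique js →
                  All (λ j → M i j ≡ z) js → length js ≤ s

-- Orient each edge of a clique {(i₁,j₁), …, (i_k,j_k)} from (i,j) to (i',j') when M i j' = 0;
-- adjacency supplies such an orientation for every pair, so choosing one per pair the
-- out-degrees sum to k C 2. The columns of a clique are pairwise distinct, so the out-neighbours of (i,j) name
-- distinct zeros of row i, and every out-degree is at most s. Hence k C 2 ≤ k s, i.e. k ≤ 2s + 1.
module Submission where

open import Defs
open import Level using (Level; _⊔_)
open import Data.Nat using (ℕ; zero; suc; _+_; _*_; _≤_; z≤n; s≤s)
open import Data.Nat.Properties
open import Data.Nat.Combinatorics using (_C_; nC1≡n; nCk+nC[k+1]≡[n+1]C[k+1])
open import Data.Nat.Tactic.RingSolver using (solve-∀)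
open import Algebra.Properties.CommutativeSemigroup +-commutativeSemigroup using (x∙yz≈y∙xz)
open import Data.Fin using (Fin)
open import Data.Product using (_×_; _,_; proj₂)
open import Data.Sum using (_⊎_; inj₁; inj₂)
open import Data.List using (List; []; _∷_; length; map)
open import Data.List.Properties using (length-map)
open import Data.List.Relation.Unary.All as All using (All; []; _∷_)
import Data.List.Relation.Unary.All.Properties as All
open import Data.List.Relation.Unary.AllPairs using (AllPairs; []; _∷_)
import Data.List.Relation.Unary.AllPairs.Properties as AllPairs
open import Data.List.Relation.Unary.Unique.Propositional using (Unique)
open import Data.List.Relation.Binary.Sublist.Propositional using (_⊆_; []; _∷_; _∷ʳ_)
open import Data.List.Relation.Binary.Sublist.Propositional.Properties using (All-resp-⊆)
import Data.List.Relation.Binary.Sublist.Propositional.Properties as Sublist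
open import Function using (_on_)
open import Relation.Binary.PropositionalEquality

[1+n]C2≡n+nC2 : ∀ n → suc n C 2 ≡ n + n C 2
[1+n]C2≡n+nC2 n = begin
  suc n C 2      ≡⟨ nCk+nC[k+1]≡[n+1]C[k+1] n 1 ⟨
  n C 1 + n C 2  ≡⟨ cong (_+ n C 2) (nC1≡n n) ⟩
  n + n C 2      ∎
  where open ≡-Reasoning

2*[1+n]C2≡[1+n]*n : ∀ n → 2 * (suc n C 2) ≡ suc n * n
2*[1+n]C2≡[1+n]*n zero    = refl
2*[1+n]C2≡[1+n]*n (suc n) = begin
  2 * (suc (suc n) C 2)       ≡⟨ cong (2 *_) ([1+n]C2≡n+nC2 (suc n)) ⟩
  2 * (suc n + suc n C 2)     ≡⟨ *-distribˡ-+ 2 (suc n) (suc n C 2) ⟩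
  2 * suc n + 2 * (suc n C 2) ≡⟨ cong (2 * suc n +_) (2*[1+n]C2≡[1+n]*n n) ⟩
  2 * suc n + suc n * n       ≡⟨ expand n ⟩
  suc (suc n) * suc n         ∎
  where
  open ≡-Reasoning
  expand : ∀ m → 2 * suc m + suc m * m ≡ suc (suc m) * suc m
  expand = solve-∀

nC2≤n*s⇒n≤2s+1 : ∀ n s → n C 2 ≤ n * s → n ≤ 2 * s + 1
nC2≤n*s⇒n≤2s+1 zero    s _ = z≤n
nC2≤n*s⇒n≤2s+1 (suc n) s h = subst (suc n ≤_) (+-comm 1 (2 * s)) (s≤s n≤2s)
  where
  open ≤-Reasoning
  n≤2s : n ≤ 2 * s
  n≤2s = *-cancelˡ-≤ (suc n) (begin
    suc n * n        ≡⟨ 2*[1+n]C2≡[1+n]*n n ⟨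
    2 * (suc n C 2)  ≤⟨ *-monoʳ-≤ 2 h ⟩
    2 * (suc n * s)  ≡⟨ swap (suc n) s ⟩
    suc n * (2 * s)  ∎)
    where
    swap : ∀ a b → 2 * (a * b) ≡ a * (2 * b)
    swap = solve-∀

AllPairs-resp-⊇ : ∀ {a r} {X : Set a} {R : X → X → Set r} {xs ys : List X} →
                  xs ⊆ ys → AllPairs R ys → AllPairs R xs
AllPairs-resp-⊇ []             []       = []
AllPairs-resp-⊇ (_ ∷ʳ xs⊆ys)   (_ ∷ ps) = AllPairs-resp-⊇ xs⊆ys ps
AllPairs-resp-⊇ (refl ∷ xs⊆ys) (r ∷ ps) = All-resp-⊆ xs⊆ys r ∷ AllPairs-resp-⊇ xs⊆ys ps

module Tournament {a r : Level} {X : Set a} (R : X → X → Set r) where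

  Comparable : X → X → Set r
  Comparable v w = R v w ⊎ R w v

  record OutNbhd (L : List X) (v : X) : Set (a ⊔ r) where
    constructor outNbhd
    field
      targets   : List X
      targets⊆L : targets ⊆ L
      dominated : All (R v) targets

  outdegree : ∀ {L v} → OutNbhd L v → ℕ
  outdegree o = length (OutNbhd.targets o)

  outdegreeSum : ∀ {K L} → All (OutNbhd K) L → ℕ
  outdegreeSum []       = 0
  outdegreeSum (o ∷ os) = outdegree o + outdegreeSum os

  weaken : ∀ {w L v} → OutNbhd L v → OutNbhd (w ∷ L) v
  weaken {w} (outNbhd ws ws⊆L rs) = outNbhd ws (w ∷ʳ ws⊆L) rs

  extend : ∀ {w L v} → R v w → OutNbhd L v → OutNbhd (w ∷ L) v
  extend r (outNbhd ws ws⊆L rs) = outNbhd (_ ∷ ws) (refl ∷ ws⊆L) (r ∷ rs)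

  -- Prepending v to a list L on which v is comparable with everything: forward is the
  -- out-neighbourhood of v, backward adds v to the out-neighbourhoods of the w with R w v.
  forward : ∀ {v L} → All (Comparable v) L → OutNbhd L v
  forward []            = outNbhd [] [] []
  forward (inj₁ r ∷ cs) = extend r (forward cs)
  forward (inj₂ _ ∷ cs) = weaken (forward cs)

  backward : ∀ {v K L} → All (Comparable v) L → All (OutNbhd K) L → All (OutNbhd (v ∷ K)) L
  backward []            []       = []
  backward (inj₁ _ ∷ cs) (o ∷ os) = weaken o ∷ backward cs os
  backward (inj₂ r ∷ cs) (o ∷ os) = extend r o ∷ backward cs os

  forward+backward : ∀ {v K L} (cs : All (Comparable v) L) (os : All (OutNbhd K) L) →
                     outdegree (forward cs) + outdegreeSum (backward cs os) ≡ length L + outdegreeSum os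
  forward+backward [] [] = refl
  forward+backward {L = _ ∷ L} (inj₁ _ ∷ cs) (o ∷ os) = cong suc (begin
    outdegree (forward cs) + (outdegree o + outdegreeSum (backward cs os))
      ≡⟨ x∙yz≈y∙xz (outdegree (forward cs)) (outdegree o) _ ⟩
    outdegree o + (outdegree (forward cs) + outdegreeSum (backward cs os))
      ≡⟨ cong (outdegree o +_) (forward+backward cs os) ⟩
    outdegree o + (length L + outdegreeSum os)
      ≡⟨ x∙yz≈y∙xz (outdegree o) (length L) _ ⟩
    length L + (outdegree o + outdegreeSum os) ∎)
    where open ≡-Reasoning
  forward+backward {L = _ ∷ L} (inj₂ _ ∷ cs) (o ∷ os) = begin
    outdegree (forward cs) + suc (outdegree o + outdegreeSum (backward cs os))
      ≡⟨ +-suc (outdegree (forward cs)) _ ⟩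
    suc (outdegree (forward cs) + (outdegree o + outdegreeSum (backward cs os)))
      ≡⟨ cong suc (x∙yz≈y∙xz (outdegree (forward cs)) (outdegree o) _) ⟩
    suc (outdegree o + (outdegree (forward cs) + outdegreeSum (backward cs os)))
      ≡⟨ cong (λ x → suc (outdegree o + x)) (forward+backward cs os) ⟩
    suc (outdegree o + (length L + outdegreeSum os))
      ≡⟨ cong suc (x∙yz≈y∙xz (outdegree o) (length L) _) ⟩
    suc (length L + (outdegree o + outdegreeSum os)) ∎
    where open ≡-Reasoning

  outNbhds : ∀ {L} → AllPairs Comparable L → All (OutNbhd L) L
  outNbhds []        = []
  outNbhds (cs ∷ ps) = weaken (forward cs) ∷ backward cs (outNbhds ps)

  outdegreeSum-outNbhds : ∀ {L} (ps : AllPairs Comparable L) → outdegreeSum (outNbhds ps) ≡ length L C 2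
  outdegreeSum-outNbhds []                 = refl
  outdegreeSum-outNbhds {_ ∷ L} (cs ∷ ps) = begin
    outdegree (forward cs) + outdegreeSum (backward cs (outNbhds ps)) ≡⟨ forward+backward cs (outNbhds ps) ⟩
    length L + outdegreeSum (outNbhds ps)                              ≡⟨ cong (length L +_) (outdegreeSum-outNbhds ps) ⟩
    length L + length L C 2                                            ≡⟨ [1+n]C2≡n+nC2 (length L) ⟨
    suc (length L) C 2                                                 ∎
    where open ≡-Reasoning

  outdegreeSum-≤ : ∀ {K s} → (∀ {v} (o : OutNbhd K v) → outdegree o ≤ s) →
                   ∀ {L} (os : All (OutNbhd K) L) → outdegreeSum os ≤ length L * s
  outdegreeSum-≤ bounded []       = z≤n
  outdegreeSum-≤ bounded (o ∷ os) = +-mono-≤ (bounded o) (outdegreeSum-≤ bounded os)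

  outdegrees≤s⇒length≤2s+1 : ∀ {L s} → AllPairs Comparable L → (∀ {v} (o : OutNbhd L v) → outdegree o ≤ s) →
                         length L ≤ 2 * s + 1
  outdegrees≤s⇒length≤2s+1 {L} {s} ps bounded = nC2≤n*s⇒n≤2s+1 (length L) s (begin
    length L C 2                ≡⟨ outdegreeSum-outNbhds ps ⟨
    outdegreeSum (outNbhds ps)  ≤⟨ outdegreeSum-≤ bounded (outNbhds ps) ⟩
    length L * s                ∎)
    where open ≤-Reasoning

module _ {a : Level} {A : Set a} (z : A) {m n : ℕ} (M : Matrix A m n) where

  CornerZero : Fin m × Fin n → Fin m × Fin n → Set a
  CornerZero (i , _) (_ , l) = M i l ≡ z

  adjacent-vertices-columns-differ : ∀ {v w} → Vertex z M v → Vertex z M w → Adjacent z M v w → proj₂ v ≢ proj₂ w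
  adjacent-vertices-columns-differ {i , _} v≢z _   (inj₁ Mil≡z) refl = v≢z Mil≡z
  adjacent-vertices-columns-differ {_} {k , _} _ w≢z (inj₂ Mkj≡z) refl = w≢z Mkj≡z

  clique-columns-unique : ∀ {L} → All (Vertex z M) L → AllPairs (Adjacent z M) L → Unique (map proj₂ L)
  clique-columns-unique vs ps = AllPairs.map⁺ (columns-differ vs ps)
    where
    columns-differ : ∀ {L} → All (Vertex z M) L → AllPairs (Adjacent z M) L → AllPairs (_≢_ on proj₂) L
    columns-differ []       []        = []
    columns-differ (v ∷ vs) (as ∷ ps) =
      All.zipWith (λ (w , a) → adjacent-vertices-columns-differ v w a) (vs , as) ∷ columns-differ vs ps

lemma5p5 : ∀ {a : Level} {A : Set a} (z : A) (m n s : ℕ) (M : Matrix A m n) →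
    (∀ (i : Fin m) → RowZeros≤ z M i s) →
    CliqueNumber≤ z M (2 * s + 1)
lemma5p5 z m n s M rows L (_ , vs , ps) = outdegrees≤s⇒length≤2s+1 ps bounded
  where
  open Tournament (CornerZero z M)
  bounded : ∀ {v} (o : OutNbhd L v) → outdegree o ≤ s
  bounded {i , _} (outNbhd ws ws⊆L rs) = subst (_≤ s) (length-map proj₂ ws)
    (rows i (map proj₂ ws)
      (AllPairs-resp-⊇ (Sublist.map⁺ proj₂ ws⊆L) (clique-columns-unique z M vs ps))
      (All.map⁺ rs))
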